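{- Let $G$ be a finite simple tripartite graph and $D$ an orientation of $G$ such that for some proper 3-coloring of $G$, one of the color classes consists only of vertices that are simplicial in $G$ and have out-degree $0$ in $D$. If $L(v)$ is a list of $d^+_D(v)+1$ positive integers for each $v\in V(G)$, then $G$ has an additive coloring assigning to each $v\in V(G)$ an element of $L(v)$.
   Context: A vertex is simplicial if its neighbors form a clique. An additive coloring of $G$ is a function $\ell:V(G)\to\mathbb{N}$ (positive integers) such that $c(v)=\sum_{u\in N_G(v)}\ell(u)$ satisfies $c(u)\neq c(v)$ whenever $\{u,v\}\in E(G)$. $d^+_D(v)$ is the out-degree of $v$ in $D$. -}

module Defs where

open import Data.Nat using (ℕ; zero; suc; _+_; _<_)
open import Data.Sum using (_⊎_)
open import Data.Bool using (Bool; true; false; if_then_else_)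
open import Data.Fin using (Fin)
open import Data.Nat.ListAction using (sum)
open import Data.List using (List; map; length; filterᵇ; allFin)
open import Data.List.Membership.Propositional using (_∈_)
open import Data.List.Relation.Unary.All using (All)
open import Data.List.Relation.Unary.Unique.Propositional using (Unique)
open import Data.Product using (Σ; _×_; ∃)
open import Relation.Binary.PropositionalEquality using (_≡_; _≢_)

record Graph (n : ℕ) : Set where
  field
    adj   : Fin n → Fin n → Bool
    sym   : ∀ u v → adj u v ≡ adj v u
    irrefl : ∀ v → adj v v ≡ false
open Graph public

Adj : ∀ {n} → Graph n → Fin n → Fin n → Set
Adj G u v = adj G u v ≡ true

-- An orientation D of G: arc u v means u → v.  Every arc is an edge, and
-- every edge {u,v} is oriented in exactly one direction.
record Orientation {n : ℕ} (G : Graph n) : Set where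
  field
    arc        : Fin n → Fin n → Bool
    arc⇒edge   : ∀ u v → arc u v ≡ true → Adj G u v
    edge⇒arc   : ∀ u v → Adj G u v → (arc u v ≡ true) ⊎ (arc v u ≡ true)
    antisym    : ∀ u v → arc u v ≡ true → arc v u ≡ false
open Orientation public

outdeg : ∀ {n} {G : Graph n} → Orientation G → Fin n → ℕ
outdeg {n} D v = length (filterᵇ (arc D v) (allFin n))

Simplicial : ∀ {n} → Graph n → Fin n → Set
Simplicial G v = ∀ u w → Adj G v u → Adj G v w → u ≢ w → Adj G u w

ProperColoring : ∀ {n} → Graph n → (k : ℕ) → (Fin n → Fin k) → Set
ProperColoring G k col = ∀ u v → Adj G u v → col u ≢ col v

neighbourSum : ∀ {n} → Graph n → (Fin n → ℕ) → Fin n → ℕ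
neighbourSum {n} G ℓ v = sum (map (λ u → if adj G v u then ℓ u else 0) (allFin n))

PositiveLabel : ∀ {n} → (Fin n → ℕ) → Set
PositiveLabel ℓ = ∀ v → 0 < ℓ v

AdditiveColoring : ∀ {n} → Graph n → (Fin n → ℕ) → Set
AdditiveColoring G ℓ =
  PositiveLabel ℓ × (∀ u v → Adj G u v → neighbourSum G ℓ u ≢ neighbourSum G ℓ v)

module Submission where

-- Relabel the colour classes as roles low < mid < high, the given class becoming mid. A vertex
-- v carries a counter k v ≤ d⁺(v): a high vertex takes the k-th smallest entry of its list, any
-- other vertex the k-th largest. Call an arc faithful when its end of lower role has the larger
-- neighbour sum. While some edge carries equal sums, increment the counter of its tail t, which
-- is not mid because mid vertices are sinks. This raises the label of a high t and lowers that
-- of a low t. If t is high and adjacent to the upper end of an edge, that end is mid, hence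
-- simplicial, so t is adjacent to the lower end as well (symmetrically for low t); thus every
-- faithful arc stays faithful and the tied arc becomes faithful. So "k v is at most the number
-- of faithful out-arcs of v" is invariant, the counters stay within their lists, and the total
-- count grows until no edge carries equal sums.

open import Defs hiding (sym)
open import Data.Nat using (ℕ; zero; suc; _+_; _∸_; _≤_; _<_; z≤n; s≤s; _<?_)
open import Data.Nat.Properties
open import Data.Nat.ListAction using (sum)
open import Data.Nat.Induction using (<-wellFounded)
open import Data.Fin using (Fin; zero; suc)
open import Data.Fin.Patterns using (0F; 1F; 2F)
open import Data.Fin.Permutation.Components using (transpose; transpose-inverse)
import Data.Fin.Properties as Fin
open import Data.Vec.Functional using (updateAt)
open import Data.Vec.Functional.Properties using (updateAt-updates; updateAt-minimal)
open import Algebra.Properties.Monoid.Sum +-0-monoid using (sum-cong-≗) renaming (sum to ∑)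
open import Algebra.Properties.CommutativeSemigroup +-commutativeSemigroup using (xy∙z≈xz∙y)
open import Data.List using (List; []; _∷_; map; length; filter; allFin; tabulate)
open import Data.List.Properties using (map-tabulate)
open import Data.List.Membership.Propositional using (_∈_)
open import Data.List.Relation.Unary.Any using (here; there)
open import Data.List.Relation.Unary.All using (All; _∷_)
import Data.List.Relation.Unary.All as All
open import Data.List.Relation.Unary.AllPairs using (_∷_)
open import Data.List.Relation.Unary.Linked using (Linked; _∷_)
open import Data.List.Relation.Unary.Unique.Propositional using (Unique)
open import Data.List.Relation.Binary.Permutation.Propositional using (↭-sym; ↭⇒↭ₛ)
open import Data.List.Relation.Binary.Permutation.Propositional.Properties using (↭-length; Any-resp-↭)
open import Data.List.Sort ≤-decTotalOrder using (sort; sort-↭; sort-↗)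
open import Data.Bool using (Bool; true; false; if_then_else_; T)
open import Data.Bool.Properties using (T-≡) renaming (_≟_ to _≟ᵇ_)
open import Data.Empty using (⊥-elim)
open import Data.Sum using (_⊎_; inj₁; inj₂; swap)
open import Data.Product using (_×_; ∃; ∃₂; _,_; proj₁; proj₂)
open import Function using (_∘_; Equivalence)
open import Relation.Nullary using (Dec; yes; no; ¬_; contradiction)
open import Relation.Nullary.Decidable using (T?; _×-dec_; _⊎-dec_)
open import Relation.Unary using (Decidable)
open import Relation.Binary.PropositionalEquality
open import Relation.Binary.PropositionalEquality.Properties using (setoid)
open import Data.List.Relation.Binary.Permutation.Setoid.Properties (setoid ℕ) using (Unique-resp-↭)
open import Induction.WellFounded using (Acc; acc)

gap : ∀ {m n} → m < n → ∃ λ δ → 0 < δ × n ≡ m + δ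
gap {m} {n} m<n = n ∸ m , m<n⇒0<n∸m m<n , sym (m+[n∸m]≡n (<⇒≤ m<n))

∑-mono : ∀ {n} {f g : Fin n → ℕ} → (∀ i → f i ≤ g i) → ∑ f ≤ ∑ g
∑-mono {zero}  _   = z≤n
∑-mono {suc n} f≤g = +-mono-≤ (f≤g zero) (∑-mono (f≤g ∘ suc))

∑-mono-< : ∀ {n} {f g : Fin n → ℕ} → (∀ i → f i ≤ g i) → ∀ t → f t < g t → ∑ f < ∑ g
∑-mono-< f≤g zero    ft<gt = +-mono-<-≤ ft<gt (∑-mono (f≤g ∘ suc))
∑-mono-< f≤g (suc t) ft<gt = +-mono-≤-< (f≤g zero) (∑-mono-< (f≤g ∘ suc) t ft<gt)

∑-update : ∀ {n} {f g : Fin n → ℕ} t {e} →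
  (∀ i → i ≢ t → g i ≡ f i) → g t ≡ f t + e → ∑ g ≡ ∑ f + e
∑-update {f = f} {g} zero {e} off at = begin
  g zero + ∑ (g ∘ suc)      ≡⟨ cong₂ _+_ at (sum-cong-≗ λ i → off (suc i) λ ()) ⟩
  f zero + e + ∑ (f ∘ suc)  ≡⟨ xy∙z≈xz∙y (f zero) e _ ⟩
  f zero + ∑ (f ∘ suc) + e  ∎
  where open ≡-Reasoning
∑-update {f = f} {g} (suc t) {e} off at = begin
  g zero + ∑ (g ∘ suc)        ≡⟨ cong₂ _+_ (off zero λ ()) (∑-update t off-suc at) ⟩
  f zero + (∑ (f ∘ suc) + e)  ≡⟨ +-assoc (f zero) _ e ⟨
  f zero + ∑ (f ∘ suc) + e    ∎
  where
  open ≡-Reasoning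
  off-suc : ∀ i → i ≢ t → g (suc i) ≡ f (suc i)
  off-suc i i≢t = off (suc i) (i≢t ∘ Fin.suc-injective)

∑-updateAt-suc : ∀ {n} (f : Fin n → ℕ) t → ∑ f < ∑ (updateAt f t suc)
∑-updateAt-suc f t = ∑-mono-< grows t (≤-reflexive (sym (updateAt-updates t f)))
  where
  grows : ∀ i → f i ≤ updateAt f t suc i
  grows i with i Fin.≟ t
  ... | yes refl = ≤-trans (n≤1+n (f i)) (≤-reflexive (sym (updateAt-updates i f)))
  ... | no i≢t   = ≤-reflexive (sym (updateAt-minimal i t f i≢t))

sum-tabulate : ∀ {n} (f : Fin n → ℕ) → sum (tabulate f) ≡ ∑ f
sum-tabulate {zero}  f = refl
sum-tabulate {suc n} f = cong (f zero +_) (sum-tabulate (f ∘ suc))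

sum-map-allFin : ∀ {n} (f : Fin n → ℕ) → sum (map f (allFin n)) ≡ ∑ f
sum-map-allFin f = trans (cong sum (map-tabulate (λ i → i) f)) (sum-tabulate f)

indicator : ∀ {P : Set} → Dec P → ℕ
indicator (yes _) = 1
indicator (no _)  = 0

indicator-mono : ∀ {P Q : Set} → (P → Q) → (p : Dec P) (q : Dec Q) → indicator p ≤ indicator q
indicator-mono P⇒Q (yes p) (yes _) = ≤-refl
indicator-mono P⇒Q (yes p) (no ¬q) = contradiction (P⇒Q p) ¬q
indicator-mono P⇒Q (no _)  _       = z≤n

indicator-< : ∀ {P Q : Set} → ¬ P → Q → (p : Dec P) (q : Dec Q) → indicator p < indicator q
indicator-< ¬p q (yes p) _      = contradiction p ¬p
indicator-< ¬p q (no _) (yes _) = s≤s z≤n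
indicator-< ¬p q (no _) (no ¬q) = contradiction q ¬q

length-filter : ∀ {A : Set} {P : A → Set} (P? : Decidable P) xs →
  length (filter P? xs) ≡ sum (map (indicator ∘ P?) xs)
length-filter P? []       = refl
length-filter P? (x ∷ xs) with P? x
... | yes _ = cong suc (length-filter P? xs)
... | no _  = length-filter P? xs

-- The junk value 0 beyond the end of the list is never used.
nth : List ℕ → ℕ → ℕ
nth []       _       = 0
nth (x ∷ _)  zero    = x
nth (_ ∷ xs) (suc j) = nth xs j

nth-∈ : ∀ xs {j} → j < length xs → nth xs j ∈ xs
nth-∈ (x ∷ xs) {zero}  _         = here refl
nth-∈ (x ∷ xs) {suc j} (s≤s j<) = there (nth-∈ xs j<)

nth-< : ∀ {xs} → Linked _≤_ xs → Unique xs → ∀ {j} → suc j < length xs →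
  nth xs j < nth xs (suc j)
nth-< {x ∷ y ∷ _} (x≤y ∷ _) ((x≢y ∷ _) ∷ _) {zero} _ = ≤∧≢⇒< x≤y x≢y
nth-< {_ ∷ []} _ _ (s≤s ())
nth-< {_ ∷ _ ∷ _} (_ ∷ sorted) (_ ∷ unique) {suc j} (s≤s j<) = nth-< sorted unique j<

enumerate : List ℕ → ℕ → ℕ
enumerate xs = nth (sort xs)

enumerate-∈ : ∀ xs {j} → j < length xs → enumerate xs j ∈ xs
enumerate-∈ xs j< =
  Any-resp-↭ (sort-↭ xs) (nth-∈ (sort xs) (subst (_ <_) (sym (↭-length (sort-↭ xs))) j<))

enumerate-< : ∀ {xs} → Unique xs → ∀ {j} → suc j < length xs → enumerate xs j < enumerate xs (suc j)
enumerate-< {xs} unique j< =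
  nth-< (sort-↗ xs) (Unique-resp-↭ (↭⇒↭ₛ (↭-sym (sort-↭ xs))) unique)
        (subst (_ <_) (sym (↭-length (sort-↭ xs))) j<)

data Role : Set where
  low mid high : Role

data _≺_ : Role → Role → Set where
  low≺mid  : low ≺ mid
  low≺high : low ≺ high
  mid≺high : mid ≺ high

_≺?_ : ∀ r s → Dec (r ≺ s)
low  ≺? low  = no λ ()
low  ≺? mid  = yes low≺mid
low  ≺? high = yes low≺high
mid  ≺? low  = no λ ()
mid  ≺? mid  = no λ ()
mid  ≺? high = yes mid≺high
high ≺? low  = no λ ()
high ≺? mid  = no λ ()
high ≺? high = no λ ()

≺-connex : ∀ {r s} → r ≢ s → r ≺ s ⊎ s ≺ r
≺-connex {low}  {low}  r≢s = contradiction refl r≢s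
≺-connex {low}  {mid}  _   = inj₁ low≺mid
≺-connex {low}  {high} _   = inj₁ low≺high
≺-connex {mid}  {low}  _   = inj₂ low≺mid
≺-connex {mid}  {mid}  r≢s = contradiction refl r≢s
≺-connex {mid}  {high} _   = inj₁ mid≺high
≺-connex {high} {low}  _   = inj₂ low≺high
≺-connex {high} {mid}  _   = inj₂ mid≺high
≺-connex {high} {high} r≢s = contradiction refl r≢s

high⊀ : ∀ {r} → ¬ (high ≺ r)
high⊀ ()

⊀low : ∀ {r} → ¬ (r ≺ low)
⊀low ()

≺-nonhigh : ∀ {r s} → r ≺ s → s ≢ high → r ≡ low × s ≡ mid
≺-nonhigh low≺mid  _      = refl , refl
≺-nonhigh low≺high s≢high = contradiction refl s≢high
≺-nonhigh mid≺high s≢high = contradiction refl s≢high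

nonlow-≺ : ∀ {r s} → r ≺ s → r ≢ low → r ≡ mid × s ≡ high
nonlow-≺ low≺mid  r≢low = contradiction refl r≢low
nonlow-≺ low≺high r≢low = contradiction refl r≢low
nonlow-≺ mid≺high _     = refl , refl

toRole : Fin 3 → Role
toRole 0F = low
toRole 1F = mid
toRole 2F = high

fromRole : Role → Fin 3
fromRole low  = 0F
fromRole mid  = 1F
fromRole high = 2F

fromRole-toRole : ∀ a → fromRole (toRole a) ≡ a
fromRole-toRole 0F = refl
fromRole-toRole 1F = refl
fromRole-toRole 2F = refl

colourRole : Fin 3 → Fin 3 → Role
colourRole i = toRole ∘ transpose i 1F

uncolourRole : Fin 3 → Role → Fin 3
uncolourRole i = transpose 1F i ∘ fromRole

uncolourRole-colourRole : ∀ i a → uncolourRole i (colourRole i a) ≡ a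
uncolourRole-colourRole i a =
  trans (cong (transpose 1F i) (fromRole-toRole (transpose i 1F a))) (transpose-inverse 1F i)

colourRole-injective : ∀ i {a b} → colourRole i a ≡ colourRole i b → a ≡ b
colourRole-injective i {a} {b} eq =
  trans (sym (uncolourRole-colourRole i a))
        (trans (cong (uncolourRole i) eq) (uncolourRole-colourRole i b))

colourRole-mid : ∀ i {a} → colourRole i a ≡ mid → a ≡ i
colourRole-mid i {a} eq = trans (sym (uncolourRole-colourRole i a)) (cong (uncolourRole i) eq)

rung : Role → ℕ → ℕ → ℕ
rung high d j = j
rung _    d j = d ∸ j

rung-≤ : ∀ r {d j} → j ≤ d → rung r d j ≤ d
rung-≤ high j≤d = j≤d
rung-≤ low  {d} {j} _ = m∸n≤m d j
rung-≤ mid  {d} {j} _ = m∸n≤m d j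

ladder : Role → List ℕ → ℕ → ℕ → ℕ
ladder r xs d = enumerate xs ∘ rung r d

ladder-∈ : ∀ r {xs d j} → length xs ≡ suc d → j ≤ d → ladder r xs d j ∈ xs
ladder-∈ r {xs} len j≤d = enumerate-∈ xs (subst (_ <_) (sym len) (s≤s (rung-≤ r j≤d)))

ladder-climbs : ∀ {r xs d j} → r ≡ high → Unique xs → length xs ≡ suc d → j < d →
  ladder r xs d j < ladder r xs d (suc j)
ladder-climbs refl unique len j<d = enumerate-< unique (subst (_ <_) (sym len) (s≤s j<d))

ladder-descends : ∀ {r xs d j} → r ≡ low → Unique xs → length xs ≡ suc d → j < d →
  ladder r xs d (suc j) < ladder r xs d j
ladder-descends {xs = xs} {d} {j} refl unique len j<d =
  subst (enumerate xs (d ∸ suc j) <_) (cong (enumerate xs) (sym d∸j≡1+d∸1+j))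
    (enumerate-< unique (subst (_ <_) (sym len) (s≤s (subst (_≤ d) d∸j≡1+d∸1+j (m∸n≤m d j)))))
  where
  d∸j≡1+d∸1+j : d ∸ j ≡ suc (d ∸ suc j)
  d∸j≡1+d∸1+j = +-∸-assoc 1 j<d

bounded-ascent : ∀ {A : Set} (Inv Done : A → Set) (μ : A → ℕ) (B : ℕ) →
  (∀ {a} → Inv a → μ a ≤ B) →
  (∀ a → Inv a → Done a ⊎ ∃ λ a′ → Inv a′ × μ a < μ a′) →
  ∀ a → Inv a → ∃ λ a → Inv a × Done a
bounded-ascent Inv Done μ B bounded progress a inv = climb a inv (<-wellFounded (B ∸ μ a))
  where
  climb : ∀ a → Inv a → Acc _<_ (B ∸ μ a) → ∃ λ a → Inv a × Done a
  climb a inv (acc rs) with progress a inv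
  ... | inj₁ done = a , inv , done
  ... | inj₂ (a′ , inv′ , μa<μa′) = climb a′ inv′ (rs (∸-monoʳ-< μa<μa′ (bounded inv′)))

ProperNeighbourSums : ∀ {n} → Graph n → (Fin n → ℕ) → Set
ProperNeighbourSums G ℓ = ∀ u v → Adj G u v → neighbourSum G ℓ u ≢ neighbourSum G ℓ v

properNeighbourSums? : ∀ {n} (G : Graph n) ℓ →
  ProperNeighbourSums G ℓ ⊎ ∃₂ λ u v → Adj G u v × neighbourSum G ℓ u ≡ neighbourSum G ℓ v
properNeighbourSums? G ℓ
  with Fin.any? (λ u → Fin.any? (λ v →
         (adj G u v ≟ᵇ true) ×-dec (neighbourSum G ℓ u ≟ neighbourSum G ℓ v)))
... | yes (u , v , u~v , tie) = inj₂ (u , v , u~v , tie)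
... | no no-tie = inj₁ λ u v u~v tie → no-tie (u , v , u~v , tie)

bump : ℕ → Bool → ℕ
bump δ b = if b then δ else 0

Raise : ∀ {n} → (Fin n → ℕ) → (Fin n → ℕ) → Fin n → ℕ → Set
Raise ℓ ℓ′ t δ = (∀ z → z ≢ t → ℓ′ z ≡ ℓ z) × ℓ′ t ≡ ℓ t + δ

neighbourSum-raise : ∀ {n} (G : Graph n) {ℓ ℓ′ t δ} → Raise ℓ ℓ′ t δ →
  ∀ y → neighbourSum G ℓ′ y ≡ neighbourSum G ℓ y + bump δ (adj G y t)
neighbourSum-raise G {ℓ} {ℓ′} {t} {δ} (off , at) y = begin
  neighbourSum G ℓ′ y              ≡⟨ sum-map-allFin (seen ℓ′) ⟩
  ∑ (seen ℓ′)                      ≡⟨ ∑-update t seen-off seen-at ⟩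
  ∑ (seen ℓ) + bump δ (adj G y t)  ≡⟨ cong (_+ _) (sum-map-allFin (seen ℓ)) ⟨
  neighbourSum G ℓ y + bump δ (adj G y t) ∎
  where
  open ≡-Reasoning
  seen : (Fin _ → ℕ) → Fin _ → ℕ
  seen ℓ u = if adj G y u then ℓ u else 0
  seen-off : ∀ u → u ≢ t → seen ℓ′ u ≡ seen ℓ u
  seen-off u u≢t with adj G y u
  ... | true  = off u u≢t
  ... | false = refl
  seen-at : seen ℓ′ t ≡ seen ℓ t + bump δ (adj G y t)
  seen-at with adj G y t
  ... | true  = at
  ... | false = refl

Dominates : ∀ {n} → Graph n → Fin n → Fin n → Fin n → Set
Dominates G t w u = (Adj G u t → Adj G w t) × (t ≡ u ⊎ t ≡ w → adj G u t ≡ false × Adj G w t)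

bump-≤ : ∀ {n} {G : Graph n} {t w u} δ → Dominates G t w u →
  bump δ (adj G u t) ≤ bump δ (adj G w t)
bump-≤ {G = G} {t} {w} {u} δ (sees , _) with adj G u t
... | false = z≤n
... | true rewrite sees refl = ≤-refl

bump-< : ∀ {n} {G : Graph n} {t w u δ} → 0 < δ → Dominates G t w u → t ≡ u ⊎ t ≡ w →
  bump δ (adj G u t) < bump δ (adj G w t)
bump-< δ>0 (_ , ends) on rewrite proj₁ (ends on) | proj₂ (ends on) = δ>0

BelowOrTiedAt : ∀ {n} → Graph n → (Fin n → ℕ) → Fin n → Fin n → Fin n → Set
BelowOrTiedAt G ℓ t u w =
  neighbourSum G ℓ u < neighbourSum G ℓ w ⊎
  (neighbourSum G ℓ u ≡ neighbourSum G ℓ w × (t ≡ u ⊎ t ≡ w))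

raise-widens : ∀ {n} (G : Graph n) {ℓ ℓ′ t δ u w} → 0 < δ → Dominates G t w u →
  Raise ℓ ℓ′ t δ → BelowOrTiedAt G ℓ t u w → neighbourSum G ℓ′ u < neighbourSum G ℓ′ w
raise-widens G {ℓ} {ℓ′} {t} {δ} {u} {w} δ>0 dom r below =
  subst₂ _<_ (sym (neighbourSum-raise G r u)) (sym (neighbourSum-raise G r w)) (widen below)
  where
  widen : BelowOrTiedAt G ℓ t u w →
    neighbourSum G ℓ u + bump δ (adj G u t) < neighbourSum G ℓ w + bump δ (adj G w t)
  widen (inj₁ lt)         = +-mono-<-≤ lt (bump-≤ {G = G} δ dom)
  widen (inj₂ (tie , on)) = +-mono-≤-< (≤-reflexive tie) (bump-< {G = G} δ>0 dom on)

raise-reflects : ∀ {n} (G : Graph n) {ℓ ℓ′ t δ u w} → 0 < δ → Dominates G t w u →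
  Raise ℓ ℓ′ t δ → BelowOrTiedAt G ℓ′ t w u → neighbourSum G ℓ w < neighbourSum G ℓ u
raise-reflects G {ℓ} {ℓ′} {t} {δ} {u} {w} δ>0 dom r below =
  +-cancelʳ-< (bump δ (adj G w t)) _ _ (narrow below)
  where
  narrow : BelowOrTiedAt G ℓ′ t w u →
    neighbourSum G ℓ w + bump δ (adj G w t) < neighbourSum G ℓ u + bump δ (adj G w t)
  narrow (inj₁ lt) =
    <-≤-trans (subst₂ _<_ (neighbourSum-raise G r w) (neighbourSum-raise G r u) lt)
              (+-monoʳ-≤ _ (bump-≤ {G = G} δ dom))
  narrow (inj₂ (tie , on)) =
    ≤-<-trans (≤-reflexive (trans (sym (neighbourSum-raise G r w)) (trans tie (neighbourSum-raise G r u))))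
              (+-monoʳ-< _ (bump-< {G = G} δ>0 dom (swap on)))

module Greedy {n : ℕ} (G : Graph n) (D : Orientation G) (role : Fin n → Role)
  (role-proper : ∀ u v → Adj G u v → role u ≢ role v)
  (mid-simplicial : ∀ v → role v ≡ mid → Simplicial G v)
  (mid-sink : ∀ v → role v ≡ mid → outdeg D v ≡ 0)
  (label : Fin n → ℕ → ℕ)
  (label-up : ∀ v j → role v ≡ high → j < outdeg D v → label v j < label v (suc j))
  (label-down : ∀ v j → role v ≡ low → j < outdeg D v → label v (suc j) < label v j)
  where

  c : (Fin n → ℕ) → Fin n → ℕ
  c = neighbourSum G

  Adj-sym : ∀ {u v} → Adj G u v → Adj G v u
  Adj-sym {u} {v} u~v = trans (Graph.sym G v u) u~v

  mid-bridge : ∀ {m u w} → role m ≡ mid → Adj G m u → Adj G m w → role u ≢ role w → Adj G u w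
  mid-bridge {m} {u} {w} m-mid m~u m~w ru≢rw = mid-simplicial m m-mid u w m~u m~w (ru≢rw ∘ cong role)

  lower-dominates-at-high : ∀ {t lo hi} → role t ≡ high → role lo ≺ role hi → Adj G lo hi →
    Dominates G t lo hi
  lower-dominates-at-high {t} {lo} {hi} t-high lo≺hi lo~hi = sees , ends
    where
    sees : Adj G hi t → Adj G lo t
    sees hi~t with ≺-nonhigh lo≺hi (λ hi-high → role-proper hi t hi~t (trans hi-high (sym t-high)))
    ... | lo-low , hi-mid =
      mid-bridge hi-mid (Adj-sym lo~hi) hi~t (subst₂ _≢_ (sym lo-low) (sym t-high) λ ())
    ends : t ≡ hi ⊎ t ≡ lo → adj G hi t ≡ false × Adj G lo t
    ends (inj₁ refl) = irrefl G t , lo~hi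
    ends (inj₂ refl) = ⊥-elim (high⊀ (subst (_≺ role hi) t-high lo≺hi))

  upper-dominates-at-low : ∀ {t lo hi} → role t ≡ low → role lo ≺ role hi → Adj G lo hi →
    Dominates G t hi lo
  upper-dominates-at-low {t} {lo} {hi} t-low lo≺hi lo~hi = sees , ends
    where
    sees : Adj G lo t → Adj G hi t
    sees lo~t with nonlow-≺ lo≺hi (λ lo-low → role-proper lo t lo~t (trans lo-low (sym t-low)))
    ... | lo-mid , hi-high =
      mid-bridge lo-mid lo~hi lo~t (subst₂ _≢_ (sym hi-high) (sym t-low) λ ())
    ends : t ≡ lo ⊎ t ≡ hi → adj G lo t ≡ false × Adj G hi t
    ends (inj₁ refl) = irrefl G t , Adj-sym lo~hi
    ends (inj₂ refl) = ⊥-elim (⊀low (subst (role lo ≺_) t-low lo≺hi))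

  Moves : (Fin n → ℕ) → (Fin n → ℕ) → Fin n → Set
  Moves ℓ ℓ′ t =
    ∃ λ δ → 0 < δ × (role t ≡ high × Raise ℓ ℓ′ t δ ⊎ role t ≡ low × Raise ℓ′ ℓ t δ)

  moves-keeps-order : ∀ {ℓ ℓ′ t lo hi} → Moves ℓ ℓ′ t → role lo ≺ role hi → Adj G lo hi →
    BelowOrTiedAt G ℓ t hi lo → c ℓ′ hi < c ℓ′ lo
  moves-keeps-order (δ , δ>0 , inj₁ (t-high , r)) lo≺hi lo~hi =
    raise-widens G δ>0 (lower-dominates-at-high t-high lo≺hi lo~hi) r
  moves-keeps-order (δ , δ>0 , inj₂ (t-low , r)) lo≺hi lo~hi =
    raise-reflects G δ>0 (upper-dominates-at-low t-low lo≺hi lo~hi) r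

  Reversed : (Fin n → ℕ) → Fin n → Fin n → Set
  Reversed ℓ lo hi = role lo ≺ role hi × c ℓ hi < c ℓ lo

  Faithful : (Fin n → ℕ) → Fin n → Fin n → Set
  Faithful ℓ x y = Reversed ℓ x y ⊎ Reversed ℓ y x

  faithful? : ∀ ℓ x y → Dec (Faithful ℓ x y)
  faithful? ℓ x y = reversed? x y ⊎-dec reversed? y x
    where
    reversed? : ∀ lo hi → Dec (Reversed ℓ lo hi)
    reversed? lo hi = (role lo ≺? role hi) ×-dec (c ℓ hi <? c ℓ lo)

  tie-unfaithful : ∀ {ℓ t h} → c ℓ t ≡ c ℓ h → ¬ Faithful ℓ t h
  tie-unfaithful tie (inj₁ (_ , lt)) = <-irrefl (sym tie) lt
  tie-unfaithful tie (inj₂ (_ , lt)) = <-irrefl tie lt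

  moves-keeps-faithful : ∀ {ℓ ℓ′ t x y} → Moves ℓ ℓ′ t → Adj G x y →
    Faithful ℓ x y → Faithful ℓ′ x y
  moves-keeps-faithful m x~y (inj₁ (x≺y , lt)) =
    inj₁ (x≺y , moves-keeps-order m x≺y x~y (inj₁ lt))
  moves-keeps-faithful m x~y (inj₂ (y≺x , lt)) =
    inj₂ (y≺x , moves-keeps-order m y≺x (Adj-sym x~y) (inj₁ lt))

  moves-repairs : ∀ {ℓ ℓ′ t h} → Moves ℓ ℓ′ t → Adj G t h → c ℓ t ≡ c ℓ h → Faithful ℓ′ t h
  moves-repairs {t = t} {h} m t~h tie with ≺-connex (role-proper t h t~h)
  ... | inj₁ t≺h = inj₁ (t≺h , moves-keeps-order m t≺h t~h (inj₂ (sym tie , inj₂ refl)))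
  ... | inj₂ h≺t = inj₂ (h≺t , moves-keeps-order m h≺t (Adj-sym t~h) (inj₂ (tie , inj₁ refl)))

  FaithfulArc : (Fin n → ℕ) → Fin n → Fin n → Set
  FaithfulArc ℓ x y = T (arc D x y) × Faithful ℓ x y

  faithfulArc? : ∀ ℓ x y → Dec (FaithfulArc ℓ x y)
  faithfulArc? ℓ x y = T? (arc D x y) ×-dec faithful? ℓ x y

  faithfulOutdeg : (Fin n → ℕ) → Fin n → ℕ
  faithfulOutdeg ℓ x = ∑ λ y → indicator (faithfulArc? ℓ x y)

  outdeg≡∑ : ∀ x → outdeg D x ≡ ∑ λ y → indicator (T? (arc D x y))
  outdeg≡∑ x =
    trans (length-filter (T? ∘ arc D x) (allFin n)) (sum-map-allFin (indicator ∘ T? ∘ arc D x))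

  faithfulOutdeg≤outdeg : ∀ ℓ x → faithfulOutdeg ℓ x ≤ outdeg D x
  faithfulOutdeg≤outdeg ℓ x =
    subst (faithfulOutdeg ℓ x ≤_) (sym (outdeg≡∑ x))
      (∑-mono λ y → indicator-mono proj₁ (faithfulArc? ℓ x y) (T? (arc D x y)))

  faithfulOutdeg<outdeg : ∀ {ℓ t h} → arc D t h ≡ true → c ℓ t ≡ c ℓ h →
    faithfulOutdeg ℓ t < outdeg D t
  faithfulOutdeg<outdeg {ℓ} {t} {h} t→h tie =
    subst (faithfulOutdeg ℓ t <_) (sym (outdeg≡∑ t))
      (∑-mono-< (λ y → indicator-mono proj₁ (faithfulArc? ℓ t y) (T? (arc D t y))) h
        (indicator-< (tie-unfaithful tie ∘ proj₂) (Equivalence.from T-≡ t→h) _ _))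

  moves-keeps-faithfulArc : ∀ {ℓ ℓ′ t} → Moves ℓ ℓ′ t → ∀ x y →
    indicator (faithfulArc? ℓ x y) ≤ indicator (faithfulArc? ℓ′ x y)
  moves-keeps-faithfulArc m x y = indicator-mono keep _ _
    where
    keep : FaithfulArc _ x y → FaithfulArc _ x y
    keep (x→y , faithful) =
      x→y , moves-keeps-faithful m (arc⇒edge D x y (Equivalence.to T-≡ x→y)) faithful

  moves-faithfulOutdeg-mono : ∀ {ℓ ℓ′ t} → Moves ℓ ℓ′ t → ∀ x →
    faithfulOutdeg ℓ x ≤ faithfulOutdeg ℓ′ x
  moves-faithfulOutdeg-mono m x = ∑-mono (moves-keeps-faithfulArc m x)

  moves-faithfulOutdeg-< : ∀ {ℓ ℓ′ t h} → Moves ℓ ℓ′ t → arc D t h ≡ true → c ℓ t ≡ c ℓ h →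
    faithfulOutdeg ℓ t < faithfulOutdeg ℓ′ t
  moves-faithfulOutdeg-< {t = t} {h} m t→h tie =
    ∑-mono-< (moves-keeps-faithfulArc m t) h
      (indicator-< (tie-unfaithful tie ∘ proj₂)
        (Equivalence.from T-≡ t→h , moves-repairs m (arc⇒edge D t h t→h) tie) _ _)

  labelling : (Fin n → ℕ) → Fin n → ℕ
  labelling k v = label v (k v)

  Justified : (Fin n → ℕ) → Set
  Justified k = ∀ v → k v ≤ faithfulOutdeg (labelling k) v

  justified-≤-outdeg : ∀ {k} → Justified k → ∀ v → k v ≤ outdeg D v
  justified-≤-outdeg just v = ≤-trans (just v) (faithfulOutdeg≤outdeg _ v)

  increment-off : ∀ k t z → z ≢ t → labelling (updateAt k t suc) z ≡ labelling k z
  increment-off k t z z≢t = cong (label z) (updateAt-minimal z t k z≢t)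

  increment-at : ∀ k t → labelling (updateAt k t suc) t ≡ label t (suc (k t))
  increment-at k t = cong (label t) (updateAt-updates t k)

  increment-moves : ∀ {k t} → role t ≢ mid → k t < outdeg D t →
    Moves (labelling k) (labelling (updateAt k t suc)) t
  increment-moves {k} {t} t-not-mid kt<d with role t in t-role
  ... | high = let δ , δ>0 , up = gap (label-up t (k t) t-role kt<d) in
    δ , δ>0 , inj₁ (refl , increment-off k t , trans (increment-at k t) up)
  ... | low = let δ , δ>0 , down = gap (label-down t (k t) t-role kt<d) in
    δ , δ>0 , inj₂ (refl , (λ z z≢t → sym (increment-off k t z z≢t)) ,
                    trans down (cong (_+ δ) (sym (increment-at k t))))
  ... | mid = contradiction refl t-not-mid

  tie-moves : ∀ {k t h} → Justified k → arc D t h ≡ true →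
    c (labelling k) t ≡ c (labelling k) h → Moves (labelling k) (labelling (updateAt k t suc)) t
  tie-moves {k} {t} just t→h tie = increment-moves t-not-mid kt<d
    where
    kt<d : k t < outdeg D t
    kt<d = ≤-<-trans (just t) (faithfulOutdeg<outdeg t→h tie)
    t-not-mid : role t ≢ mid
    t-not-mid t-mid = n≮0 (subst (k t <_) (mid-sink t t-mid) kt<d)

  increment-justified : ∀ {k t h} → Justified k → arc D t h ≡ true →
    c (labelling k) t ≡ c (labelling k) h → Justified (updateAt k t suc)
  increment-justified {k} {t} just t→h tie v with v Fin.≟ t
  ... | yes refl = begin
    updateAt k v suc v                              ≡⟨ updateAt-updates v k ⟩
    suc (k v)                                       ≤⟨ s≤s (just v) ⟩
    suc (faithfulOutdeg (labelling k) v)            ≤⟨ moves-faithfulOutdeg-< (tie-moves just t→h tie) t→h tie ⟩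
    faithfulOutdeg (labelling (updateAt k v suc)) v ∎
    where open ≤-Reasoning
  ... | no v≢t = begin
    updateAt k t suc v                              ≡⟨ updateAt-minimal v t k v≢t ⟩
    k v                                             ≤⟨ just v ⟩
    faithfulOutdeg (labelling k) v                  ≤⟨ moves-faithfulOutdeg-mono (tie-moves just t→h tie) v ⟩
    faithfulOutdeg (labelling (updateAt k t suc)) v ∎
    where open ≤-Reasoning

  progress : ∀ k → Justified k →
    ProperNeighbourSums G (labelling k) ⊎ ∃ λ k′ → Justified k′ × ∑ k < ∑ k′
  progress k just with properNeighbourSums? G (labelling k)
  ... | inj₁ proper = inj₁ proper
  ... | inj₂ (u , v , u~v , tie) with edge⇒arc D u v u~v
  ...   | inj₁ u→v = inj₂ (_ , increment-justified just u→v tie , ∑-updateAt-suc k u)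
  ...   | inj₂ v→u = inj₂ (_ , increment-justified just v→u (sym tie) , ∑-updateAt-suc k v)

  greedy : ∃ λ k → (∀ v → k v ≤ outdeg D v) × ProperNeighbourSums G (labelling k)
  greedy =
    let k , just , proper =
          bounded-ascent Justified (ProperNeighbourSums G ∘ labelling) ∑ (∑ (outdeg D))
            (∑-mono ∘ justified-≤-outdeg) progress (λ _ → 0) (λ _ → z≤n)
    in k , justified-≤-outdeg just , proper

mainTheorem6 : (n : ℕ) (G : Graph n) (D : Orientation G) →
    (∃ λ (col : Fin n → Fin 3) → ProperColoring G 3 col ×
      (∃ λ (i : Fin 3) → ∀ v → col v ≡ i → Simplicial G v × outdeg D v ≡ 0)) →
    (L : Fin n → List ℕ) →
    (∀ v → length (L v) ≡ suc (outdeg D v)) →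
    (∀ v → Unique (L v)) →
    (∀ v → All (λ x → 0 < x) (L v)) →
    ∃ λ (ℓ : Fin n → ℕ) → AdditiveColoring G ℓ × (∀ v → ℓ v ∈ L v)
mainTheorem6 n G D (col , proper , i , i-class) L length-L unique-L positive-L =
  let k , k≤d , sums-proper = greedy
      label-∈ v = ladder-∈ (role v) (length-L v) (k≤d v)
  in labelling k , ((λ v → All.lookup (positive-L v) (label-∈ v)) , sums-proper) , label-∈
  where
  role : Fin n → Role
  role = colourRole i ∘ col
  open Greedy G D role (λ u v u~v → proper u v u~v ∘ colourRole-injective i)
    (λ v → proj₁ ∘ i-class v ∘ colourRole-mid i) (λ v → proj₂ ∘ i-class v ∘ colourRole-mid i)
    (λ v → ladder (role v) (L v) (outdeg D v))
    (λ v j v-high → ladder-climbs v-high (unique-L v) (length-L v))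
    (λ v j v-low → ladder-descends v-low (unique-L v) (length-L v))
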